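{- For positive integers $m,n$, let $K_m$ and $K_n$ be the complete graphs on $m$ and $n$ vertices. Then \[ \gamma_{1/2}(K_m \square K_n) = \left\lceil \frac{m+n-\sqrt{m^2+n^2}}{2} \right\rceil. \]
   Context: For a graph $G=(V,E)$ and a vertex $v$, $N[v]$ denotes the closed neighborhood of $v$, and for $S\subseteq V$, $N[S]=\bigcup_{u\in S}N[u]$. For $p\in[0,1]$, a set $S\subseteq V$ is a $p$-dominating set if $|N[S]|/|V|\geq p$; $\gamma_p(G)$ is the minimum cardinality of a $p$-dominating set of $G$. $G\square H$ denotes the Cartesian product of graphs $G$ and $H$. -}

module Defs where

open import Data.Nat using (ℕ; _+_; _*_; _∸_; _^_; _≤_)
open import Data.Bool using (Bool; true; false; _∧_; _∨_; not)
open import Data.Fin using (Fin; quotRem; combine)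
open import Data.Fin.Properties using (_≟_)
open import Data.Fin.Subset using (Subset; ∣_∣)
open import Data.Vec using (tabulate; lookup)
open import Data.Vec.Functional using (foldr)
open import Data.Product using (_×_; proj₁; proj₂)
open import Relation.Nullary.Decidable using (⌊_⌋)
open import Relation.Binary.PropositionalEquality using (_≡_; refl; cong; cong₂) renaming (sym to ≡-sym)
open import Relation.Nullary using (yes; no)
open import Data.Empty using (⊥-elim)

record Graph : Set where
  field
    order  : ℕ
    adj    : Fin order → Fin order → Bool
    sym    : ∀ u v → adj u v ≡ adj v u
    irrefl : ∀ u → adj u u ≡ false
open Graph public

_==_ : ∀ {n} → Fin n → Fin n → Bool
u == v = ⌊ u ≟ v ⌋

anyFin : ∀ {n} → (Fin n → Bool) → Bool
anyFin {n} f = foldr _∨_ false f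

==-sym : ∀ {n} (u v : Fin n) → (u == v) ≡ (v == u)
==-sym u v with u ≟ v | v ≟ u
... | yes _ | yes _ = refl
... | no _  | no _  = refl
... | yes p | no q  = ⊥-elim (q (≡-sym p))
... | no p  | yes q = ⊥-elim (p (≡-sym q))

==-refl : ∀ {n} (u : Fin n) → (u == u) ≡ true
==-refl u with u ≟ u
... | yes _ = refl
... | no ne = ⊥-elim (ne refl)

∧-false : ∀ b → (b ∧ false) ≡ false
∧-false true = refl
∧-false false = refl

K : ℕ → Graph
K n = record
  { order = n
  ; adj = λ u v → not (u == v)
  ; sym = λ u v → cong not (==-sym u v)
  ; irrefl = λ u → cong not (==-refl u)
  }

adj□ : (G H : Graph) → Fin (order G) → Fin (order H) → Fin (order G) → Fin (order H) → Bool
adj□ G H g h g' h' = ((g == g') ∧ adj H h h') ∨ ((h == h') ∧ adj G g g')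

adj□-sym : ∀ G H g h g' h' → adj□ G H g h g' h' ≡ adj□ G H g' h' g h
adj□-sym G H g h g' h' = cong₂ _∨_ (cong₂ _∧_ (==-sym g g') (Graph.sym H h h'))
                                   (cong₂ _∧_ (==-sym h h') (Graph.sym G g g'))

adj□-irr : ∀ G H g h → adj□ G H g h g h ≡ false
adj□-irr G H g h rewrite Graph.irrefl H h | Graph.irrefl G g
  | ∧-false (g == g) | ∧-false (h == h) = refl

-- Cartesian product G □ H on Fin (order G * order H); the vertex
-- combine g h corresponds to the pair (g , h); quotRem inverts combine:
-- quotRem (order H) (combine g h) ≡ (h , g).
_□_ : Graph → Graph → Graph
G □ H = record
  { order = order G * order H
  ; adj = λ x y → adj□ G H (fst x) (snd x) (fst y) (snd y)
  ; sym = λ x y → adj□-sym G H (fst x) (snd x) (fst y) (snd y)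
  ; irrefl = λ x → adj□-irr G H (fst x) (snd x)
  }
  where
  fst : Fin (order G * order H) → Fin (order G)
  fst x = proj₂ (quotRem {order G} (order H) x)
  snd : Fin (order G * order H) → Fin (order H)
  snd x = proj₁ (quotRem {order G} (order H) x)

N[_]of_ : (G : Graph) → Subset (order G) → Subset (order G)
N[ G ]of S = tabulate λ v → anyFin λ u → lookup S u ∧ ((u == v) ∨ adj G u v)

-- S is a p-dominating set for p = a / b (b > 0):  |N[S]| / |V| ≥ a / b,
-- written without division as  a * |V| ≤ b * |N[S]|.
IsPDominating : (a b : ℕ) (G : Graph) → Subset (order G) → Set
IsPDominating a b G S = a * order G ≤ b * ∣ N[ G ]of S ∣

record IsGammaP (a b : ℕ) (G : Graph) (k : ℕ) : Set where
  field
    witness      : Subset (order G)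
    witnessSize  : ∣ witness ∣ ≡ k
    witnessDom   : IsPDominating a b G witness
    minimal      : ∀ S → IsPDominating a b G S → k ≤ ∣ S ∣

-- k = ⌈ (m + n - √(m² + n²)) / 2 ⌉.  Since this real number is ≥ 0,
-- its ceiling is the least k ∈ ℕ with 2k ≥ m + n - √(m²+n²), i.e. with
-- m + n - 2k ≤ √(m²+n²), i.e. (using truncated subtraction)
-- (m + n ∸ 2k)² ≤ m² + n².
record IsCeilFormula (m n k : ℕ) : Set where
  field
    satisfies : (m + n ∸ 2 * k) ^ 2 ≤ m ^ 2 + n ^ 2
    least     : ∀ j → (m + n ∸ 2 * j) ^ 2 ≤ m ^ 2 + n ^ 2 → k ≤ j

-- In K_m □ K_n the closed neighbourhood of a vertex is its row together with its column, so a
-- set S dominates exactly the vertices whose row or column meets S. If S meets r rows and c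
-- columns, the (m − r)(n − c) remaining vertices are undominated, hence S is 1/2-dominating iff
-- 2(m − r)(n − c) ≤ mn; as r, c ≤ |S|, every 1/2-dominating S has 2(m − |S|)(n − |S|) ≤ mn,
-- and for s ≤ min(m, n) the diagonal of size s meets s rows and s columns. So γ_{1/2} is the
-- least s with 2(m − s)(n − s) ≤ mn. With a = m − s and b = n − s the identity
-- (a + b)² + 2(a + s)(b + s) = (a + s)² + (b + s)² + 4ab turns this condition into
-- (m + n − 2s)² ≤ m² + n², i.e. 2s ≥ m + n − √(m² + n²).
module Submission where

open import Defs hiding (sym)
open import Data.Nat using (ℕ; zero; suc; _+_; _*_; _∸_; _^_; _≤_; _<_; _<ᵇ_; z≤n; s≤s)
open import Data.Nat.Properties
open import Data.Nat.Tactic.RingSolver using (solve-∀)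
open import Algebra.Properties.Semiring.Sum +-*-semiring
  using (sum; sum-syntax; sum-cong-≗; sum-replicate-zero; ∑-comm; ∑-distrib-+; *-distribʳ-sum)
import Algebra.Properties.CommutativeMonoid.Sum as CommutativeMonoidSum
open import Data.Bool using (Bool; true; false; _∧_; _∨_; not; T)
open import Data.Bool.Properties using (∨-commutativeMonoid; ∧-distribˡ-∨; T-∧; T-∨)
open import Data.Fin using (Fin; zero; suc; toℕ; fromℕ<; inject≤; combine; quotRem; _↑ˡ_; _↑ʳ_)
open import Data.Fin.Properties
  using (toℕ-injective; toℕ-inject≤; toℕ-fromℕ<; remQuot-combine; combine-remQuot)
  renaming (_≟_ to _≟ᶠ_)
open import Data.Fin.Subset using (Subset; ∣_∣)
open import Data.Product using (_,_; proj₁; proj₂)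
open import Data.Sum using (inj₁; inj₂)
open import Data.Unit using (tt)
open import Data.Vec using ([]; _∷_; tabulate; lookup)
open import Data.Vec.Properties using (lookup∘tabulate)
open import Function using (_∘_; _⇔_; mk⇔; Equivalence)
open import Relation.Binary.PropositionalEquality
open import Relation.Nullary using (yes; no; contradiction)

-- anyFin is definitionally the sum in the commutative monoid (Bool, _∨_, false).
module ∨-Sum = CommutativeMonoidSum ∨-commutativeMonoid

𝟙 : Bool → ℕ
𝟙 true  = 1
𝟙 false = 0

𝟙-mono : ∀ {a b} → (T a → T b) → 𝟙 a ≤ 𝟙 b
𝟙-mono {false}         _   = z≤n
𝟙-mono {true} {false} a⇒b = contradiction (a⇒b tt) λ ()
𝟙-mono {true} {true}  _   = ≤-refl

count : ∀ {n} → (Fin n → Bool) → ℕ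
count {n} P = ∑[ i < n ] 𝟙 (P i)

∑-mono-≤ : ∀ {n} {f g : Fin n → ℕ} → (∀ i → f i ≤ g i) → sum f ≤ sum g
∑-mono-≤ {zero}  _   = z≤n
∑-mono-≤ {suc n} f≤g = +-mono-≤ (f≤g zero) (∑-mono-≤ (f≤g ∘ suc))

∑-const : ∀ n c → ∑[ i < n ] c ≡ n * c
∑-const zero    c = refl
∑-const (suc n) c = cong (c +_) (∑-const n c)

∑-↑ : ∀ a b (f : Fin (a + b) → ℕ) → sum f ≡ ∑[ i < a ] f (i ↑ˡ b) + ∑[ j < b ] f (a ↑ʳ j)
∑-↑ zero    b f = refl
∑-↑ (suc a) b f = trans (cong (f zero +_) (∑-↑ a b (f ∘ suc))) (sym (+-assoc (f zero) _ _))

∑-combine : ∀ m n (f : Fin (m * n) → ℕ) → sum f ≡ ∑[ i < m ] ∑[ j < n ] f (combine i j)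
∑-combine zero    n f = refl
∑-combine (suc m) n f =
  trans (∑-↑ n (m * n) f) (cong (∑[ j < n ] f (j ↑ˡ (m * n)) +_) (∑-combine m n (f ∘ (n ↑ʳ_))))

count-cong : ∀ {n} {P Q : Fin n → Bool} → (∀ i → P i ≡ Q i) → count P ≡ count Q
count-cong P≡Q = sum-cong-≗ (cong 𝟙 ∘ P≡Q)

count-mono : ∀ {n} {P Q : Fin n → Bool} → (∀ i → T (P i) → T (Q i)) → count P ≤ count Q
count-mono P⇒Q = ∑-mono-≤ (𝟙-mono ∘ P⇒Q)

count-false : ∀ {n} → count {n} (λ _ → false) ≡ 0
count-false {n} = sum-replicate-zero n

count-true : ∀ {n} → count {n} (λ _ → true) ≡ n
count-true {zero}  = refl
count-true {suc n} = cong suc count-true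

count-+-count-not : ∀ {n} (P : Fin n → Bool) → count P + count (not ∘ P) ≡ n
count-+-count-not {n} P = begin
  count P + count (not ∘ P)         ≡⟨ ∑-distrib-+ (𝟙 ∘ P) (𝟙 ∘ not ∘ P) ⟨
  ∑[ i < n ] (𝟙 (P i) + 𝟙 (not (P i))) ≡⟨ sum-cong-≗ (𝟙-+-𝟙-not ∘ P) ⟩
  count {n} (λ _ → true)            ≡⟨ count-true ⟩
  n                                 ∎
  where
  open ≡-Reasoning
  𝟙-+-𝟙-not : ∀ b → 𝟙 b + 𝟙 (not b) ≡ 1
  𝟙-+-𝟙-not true  = refl
  𝟙-+-𝟙-not false = refl

count-not : ∀ {n} (P : Fin n → Bool) → count (not ∘ P) ≡ n ∸ count P
count-not {n} P = trans (sym (m+n∸m≡n (count P) _)) (cong (_∸ count P) (count-+-count-not P))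

count-== : ∀ {n} (a : Fin n) → count (a ==_) ≡ 1
count-== {suc n} zero = cong suc (count-false {n})
count-== {suc n} (suc a) = trans (count-cong (suc-==-suc a)) (count-== a)
  where
  suc-==-suc : ∀ {n} (a j : Fin n) → (suc a == suc j) ≡ (a == j)
  suc-==-suc a j with a ≟ᶠ j
  ... | yes _ = refl
  ... | no  _ = refl

count-<ᵇ : ∀ {n k} → k ≤ n → count {n} (λ i → toℕ i <ᵇ k) ≡ k
count-<ᵇ {n}     {zero}  _         = count-false {n}
count-<ᵇ {suc n} {suc k} (s≤s k≤n) = cong suc (count-<ᵇ k≤n)

count-∨ : ∀ {m n} (P : Fin m → Bool) (Q : Fin n → Bool) →
  ∑[ i < m ] count (λ j → P i ∨ Q j) + count (not ∘ P) * count (not ∘ Q) ≡ m * n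
count-∨ {m} {n} P Q = begin
  ∑[ i < m ] count (λ j → P i ∨ Q j) + count (not ∘ P) * count (not ∘ Q)
    ≡⟨ cong (∑[ i < m ] count (λ j → P i ∨ Q j) +_)
            (*-distribʳ-sum (count (not ∘ Q)) (𝟙 ∘ not ∘ P)) ⟩
  ∑[ i < m ] count (λ j → P i ∨ Q j) + ∑[ i < m ] (𝟙 (not (P i)) * count (not ∘ Q))
    ≡⟨ ∑-distrib-+ (λ i → count (λ j → P i ∨ Q j)) _ ⟨
  ∑[ i < m ] (count (λ j → P i ∨ Q j) + 𝟙 (not (P i)) * count (not ∘ Q))
    ≡⟨ sum-cong-≗ (λ i → row-count (P i)) ⟩
  ∑[ i < m ] n
    ≡⟨ ∑-const m n ⟩
  m * n ∎
  where
  open ≡-Reasoning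
  row-count : ∀ b → count (λ j → b ∨ Q j) + 𝟙 (not b) * count (not ∘ Q) ≡ n
  row-count true  = trans (+-identityʳ _) count-true
  row-count false = trans (cong (count Q +_) (+-identityʳ _)) (count-+-count-not Q)

∣∣≡count : ∀ {n} (S : Subset n) → ∣ S ∣ ≡ count (lookup S)
∣∣≡count []          = refl
∣∣≡count (true  ∷ S) = cong suc (∣∣≡count S)
∣∣≡count (false ∷ S) = ∣∣≡count S

anyFin-∨ : ∀ {n} (f g : Fin n → Bool) → anyFin (λ u → f u ∨ g u) ≡ anyFin f ∨ anyFin g
anyFin-∨ = ∨-Sum.∑-distrib-+

anyFin-intro : ∀ {n} (f : Fin n → Bool) i → T (f i) → T (anyFin f)
anyFin-intro f zero    fi = Equivalence.from T-∨ (inj₁ fi)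
anyFin-intro f (suc i) fi = Equivalence.from T-∨ (inj₂ (anyFin-intro (f ∘ suc) i fi))

𝟙-anyFin≤count : ∀ {n} (f : Fin n → Bool) → 𝟙 (anyFin f) ≤ count f
𝟙-anyFin≤count {zero}  f = z≤n
𝟙-anyFin≤count {suc n} f with f zero
... | true  = s≤s z≤n
... | false = 𝟙-anyFin≤count (f ∘ suc)

image : ∀ {a b} → (Fin a → Bool) → (Fin a → Fin b) → Fin b → Bool
image S p j = anyFin (λ u → S u ∧ (p u == j))

image-∋ : ∀ {a b} (S : Fin a → Bool) (p : Fin a → Fin b) u → T (S u) → T (image S p (p u))
image-∋ S p u Su = anyFin-intro _ u (Equivalence.from T-∧ (Su , subst T (sym (==-refl (p u))) tt))

count-image≤ : ∀ {a b} (S : Fin a → Bool) (p : Fin a → Fin b) → count (image S p) ≤ count S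
count-image≤ {a} {b} S p = begin
  count (image S p)                          ≤⟨ ∑-mono-≤ (λ j → 𝟙-anyFin≤count (λ u → S u ∧ (p u == j))) ⟩
  ∑[ j < b ] ∑[ u < a ] 𝟙 (S u ∧ (p u == j)) ≡⟨ ∑-comm (λ j u → 𝟙 (S u ∧ (p u == j))) ⟩
  ∑[ u < a ] ∑[ j < b ] 𝟙 (S u ∧ (p u == j)) ≡⟨ sum-cong-≗ (λ u → count-∧-== (S u) (p u)) ⟩
  count S                                    ∎
  where
  open ≤-Reasoning
  count-∧-== : ∀ c (i : Fin b) → count (λ j → c ∧ (i == j)) ≡ 𝟙 c
  count-∧-== true  i = count-== i
  count-∧-== false i = count-false {b}

count-≥-initial : ∀ {k n} (k≤n : k ≤ n) (P : Fin n → Bool) →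
  (∀ (u : Fin k) → T (P (inject≤ u k≤n))) → k ≤ count P
count-≥-initial {k} {n} k≤n P P-initial = begin
  k                            ≡⟨ count-<ᵇ k≤n ⟨
  count {n} (λ i → toℕ i <ᵇ k) ≤⟨ count-mono P-below-k ⟩
  count P                      ∎
  where
  open ≤-Reasoning
  P-below-k : ∀ i → T (toℕ i <ᵇ k) → T (P i)
  P-below-k i i<ᵇk = subst (T ∘ P) inject≤-fromℕ< (P-initial (fromℕ< i<k))
    where
    i<k : toℕ i < k
    i<k = <ᵇ⇒< (toℕ i) k i<ᵇk
    inject≤-fromℕ< : inject≤ (fromℕ< i<k) k≤n ≡ i
    inject≤-fromℕ< = toℕ-injective (trans (toℕ-inject≤ (fromℕ< i<k) k≤n) (toℕ-fromℕ< i<k))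

CeilBound : ℕ → ℕ → ℕ → Set
CeilBound m n s = (m + n ∸ 2 * s) ^ 2 ≤ m ^ 2 + n ^ 2

ceilBound-≥ˡ : ∀ m n {s} → m ≤ s → CeilBound m n s
ceilBound-≥ˡ m n {s} m≤s = begin
  (m + n ∸ 2 * s) ^ 2 ≤⟨ ^-monoˡ-≤ 2 (m≤n+o⇒m∸n≤o (m + n) (2 * s) (+-monoˡ-≤ n m≤2s)) ⟩
  n ^ 2               ≤⟨ m≤n+m (n ^ 2) (m ^ 2) ⟩
  m ^ 2 + n ^ 2       ∎
  where
  open ≤-Reasoning
  m≤2s : m ≤ 2 * s
  m≤2s = ≤-trans m≤s (m≤m+n s (s + 0))

ceilBound-≥ʳ : ∀ m n {s} → n ≤ s → CeilBound m n s
ceilBound-≥ʳ m n {s} n≤s =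
  subst₂ (λ a b → (a ∸ 2 * s) ^ 2 ≤ b) (+-comm n m) (+-comm (n ^ 2) (m ^ 2)) (ceilBound-≥ˡ n m n≤s)

+-trade-≤⇔ : ∀ {x y z w} → x + 2 * y ≡ z + 2 * w → x ≤ z ⇔ w ≤ y
+-trade-≤⇔ {x} {y} {z} {w} eq = mk⇔
  (λ x≤z → *-cancelˡ-≤ 2 (+-cancelˡ-≤ z _ _ (subst (_≤ z + 2 * y) eq (+-monoˡ-≤ (2 * y) x≤z))))
  (λ w≤y → +-cancelʳ-≤ (2 * y) _ _ (subst (_≤ z + 2 * y) (sym eq) (+-monoʳ-≤ z (*-monoʳ-≤ 2 w≤y))))

ceilBound-shifted⇔ : ∀ a b s → CeilBound (a + s) (b + s) s ⇔ 2 * (a * b) ≤ (a + s) * (b + s)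
ceilBound-shifted⇔ a b s =
  subst (λ t → t ^ 2 ≤ (a + s) ^ 2 + (b + s) ^ 2 ⇔ 2 * (a * b) ≤ (a + s) * (b + s)) (sym shift)
    (+-trade-≤⇔ (identity a b s))
  where
  regroup : ∀ a b s → (a + s) + (b + s) ≡ (a + b) + 2 * s
  regroup = solve-∀
  shift : (a + s) + (b + s) ∸ 2 * s ≡ a + b
  shift = trans (cong (_∸ 2 * s) (regroup a b s)) (m+n∸n≡m (a + b) (2 * s))
  -- x ^ 2 is spelt out as x * (x * 1), its normal form, because the ring solver does not accept _^_.
  identity : ∀ a b s → (a + b) * ((a + b) * 1) + 2 * ((a + s) * (b + s))
                       ≡ ((a + s) * ((a + s) * 1) + (b + s) * ((b + s) * 1)) + 2 * (2 * (a * b))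
  identity = solve-∀

ceilBound⇔ : ∀ {m n s} → s ≤ m → s ≤ n → CeilBound m n s ⇔ 2 * ((m ∸ s) * (n ∸ s)) ≤ m * n
ceilBound⇔ {m} {n} {s} s≤m s≤n =
  subst₂ (λ m′ n′ → CeilBound m′ n′ s ⇔ 2 * ((m ∸ s) * (n ∸ s)) ≤ m′ * n′)
    (m∸n+n≡m s≤m) (m∸n+n≡m s≤n) (ceilBound-shifted⇔ (m ∸ s) (n ∸ s) s)

ceilBound-of-half : ∀ {m n} s → 2 * ((m ∸ s) * (n ∸ s)) ≤ m * n → CeilBound m n s
ceilBound-of-half {m} {n} s half with ≤-total s m | ≤-total s n
... | inj₁ s≤m | inj₁ s≤n = Equivalence.from (ceilBound⇔ s≤m s≤n) half
... | inj₂ m≤s | _         = ceilBound-≥ˡ m n m≤s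
... | inj₁ _   | inj₂ n≤s  = ceilBound-≥ʳ m n n≤s

half≤⇔≤half : ∀ {a u t} → a + u ≡ t → t ≤ 2 * a ⇔ 2 * u ≤ t
half≤⇔≤half {a} {u} refl = mk⇔
  (λ t≤2a → subst (_≤ a + u) (sym (double u))
    (+-monoˡ-≤ u (+-cancelˡ-≤ a _ _ (subst (a + u ≤_) (double a) t≤2a))))
  (λ 2u≤t → subst (a + u ≤_) (sym (double a))
    (+-monoʳ-≤ a (+-cancelʳ-≤ u _ _ (subst (_≤ a + u) (double u) 2u≤t))))
  where
  double : ∀ x → 2 * x ≡ x + x
  double x = cong (x +_) (+-identityʳ x)

module RookGraph (m n : ℕ) where

  -- The coordinates used by _□_, so that adj (K m □ K n) x y unfolds to adj□ applied to them.
  row : Fin (m * n) → Fin m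
  row x = proj₂ (quotRem {m} n x)

  col : Fin (m * n) → Fin n
  col x = proj₁ (quotRem {m} n x)

  row-combine : ∀ i j → row (combine i j) ≡ i
  row-combine i j = cong proj₁ (remQuot-combine {m} {n} i j)

  col-combine : ∀ i j → col (combine i j) ≡ j
  col-combine i j = cong proj₂ (remQuot-combine {m} {n} i j)

  ==-row-col : ∀ x y → (x == y) ≡ (row x == row y) ∧ (col x == col y)
  ==-row-col x y with x ≟ᶠ y | row x ≟ᶠ row y | col x ≟ᶠ col y
  ... | yes _    | yes _   | yes _   = refl
  ... | yes refl | no r≢r  | _       = contradiction refl r≢r
  ... | yes refl | yes _   | no c≢c  = contradiction refl c≢c
  ... | no x≢y   | yes r≡r | yes c≡c = contradiction (row-col-injective r≡r c≡c) x≢y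
    where
    row-col-injective : row x ≡ row y → col x ≡ col y → x ≡ y
    row-col-injective r≡r c≡c = begin
      x                         ≡⟨ combine-remQuot {m} n x ⟨
      combine (row x) (col x)   ≡⟨ cong₂ combine r≡r c≡c ⟩
      combine (row y) (col y)   ≡⟨ combine-remQuot {m} n y ⟩
      y                         ∎
      where open ≡-Reasoning
  ... | no _     | no _    | _       = refl
  ... | no _     | yes _   | no _    = refl

  closed-adj : ∀ x y → (x == y) ∨ adj (K m □ K n) x y ≡ (row x == row y) ∨ (col x == col y)
  closed-adj x y = trans (cong (_∨ adj (K m □ K n) x y) (==-row-col x y))
                         (both∨exactlyOne (row x == row y) (col x == col y))
    where
    both∨exactlyOne : ∀ a b → (a ∧ b) ∨ ((a ∧ not b) ∨ (b ∧ not a)) ≡ a ∨ b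
    both∨exactlyOne true  true  = refl
    both∨exactlyOne true  false = refl
    both∨exactlyOne false true  = refl
    both∨exactlyOne false false = refl

  rows : Subset (m * n) → Fin m → Bool
  rows S = image (lookup S) row

  cols : Subset (m * n) → Fin n → Bool
  cols S = image (lookup S) col

  lookup-N[] : ∀ S y → lookup (N[ K m □ K n ]of S) y ≡ rows S (row y) ∨ cols S (col y)
  lookup-N[] S y = begin
    lookup (N[ K m □ K n ]of S) y
      ≡⟨ lookup∘tabulate _ y ⟩
    anyFin (λ u → lookup S u ∧ ((u == y) ∨ adj (K m □ K n) u y))
      ≡⟨ ∨-Sum.sum-cong-≗ (λ u →
           trans (cong (lookup S u ∧_) (closed-adj u y)) (∧-distribˡ-∨ (lookup S u) _ _)) ⟩
    anyFin (λ u → (lookup S u ∧ (row u == row y)) ∨ (lookup S u ∧ (col u == col y)))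
      ≡⟨ anyFin-∨ (λ u → lookup S u ∧ (row u == row y)) (λ u → lookup S u ∧ (col u == col y)) ⟩
    rows S (row y) ∨ cols S (col y) ∎
    where open ≡-Reasoning

  ∣N[]∣+uncovered : ∀ S →
    ∣ N[ K m □ K n ]of S ∣ + (m ∸ count (rows S)) * (n ∸ count (cols S)) ≡ m * n
  ∣N[]∣+uncovered S = begin
    ∣ N[ K m □ K n ]of S ∣ + (m ∸ count (rows S)) * (n ∸ count (cols S))
      ≡⟨ cong₂ _+_ ∣N[]∣≡ (cong₂ _*_ (count-not (rows S)) (count-not (cols S))) ⟨
    ∑[ i < m ] count (λ j → rows S i ∨ cols S j) + count (not ∘ rows S) * count (not ∘ cols S)
      ≡⟨ count-∨ (rows S) (cols S) ⟩
    m * n ∎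
    where
    open ≡-Reasoning
    ∣N[]∣≡ : ∑[ i < m ] count (λ j → rows S i ∨ cols S j) ≡ ∣ N[ K m □ K n ]of S ∣
    ∣N[]∣≡ = sym (begin
      ∣ N[ K m □ K n ]of S ∣
        ≡⟨ ∣∣≡count (N[ K m □ K n ]of S) ⟩
      count (lookup (N[ K m □ K n ]of S))
        ≡⟨ count-cong (lookup-N[] S) ⟩
      count (λ y → rows S (row y) ∨ cols S (col y))
        ≡⟨ ∑-combine m n _ ⟩
      ∑[ i < m ] ∑[ j < n ] 𝟙 (rows S (row (combine i j)) ∨ cols S (col (combine i j)))
        ≡⟨ sum-cong-≗ (λ i → count-cong (λ j →
             cong₂ (λ a b → rows S a ∨ cols S b) (row-combine i j) (col-combine i j))) ⟩
      ∑[ i < m ] count (λ j → rows S i ∨ cols S j) ∎)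

  half-dominating⇔ : ∀ S → IsPDominating 1 2 (K m □ K n) S ⇔
    2 * ((m ∸ count (rows S)) * (n ∸ count (cols S))) ≤ m * n
  half-dominating⇔ S = subst (λ t → t ≤ 2 * ∣N[S]∣ ⇔ 2 * uncovered ≤ m * n)
    (sym (*-identityˡ (m * n))) (half≤⇔≤half {∣N[S]∣} {uncovered} (∣N[]∣+uncovered S))
    where
    ∣N[S]∣ uncovered : ℕ
    ∣N[S]∣ = ∣ N[ K m □ K n ]of S ∣
    uncovered = (m ∸ count (rows S)) * (n ∸ count (cols S))

  half-dominating⇒ : ∀ S → IsPDominating 1 2 (K m □ K n) S →
    2 * ((m ∸ ∣ S ∣) * (n ∸ ∣ S ∣)) ≤ m * n
  half-dominating⇒ S dom = ≤-trans
    (*-monoʳ-≤ 2 (*-mono-≤ (∸-monoʳ-≤ m (image≤ row)) (∸-monoʳ-≤ n (image≤ col))))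
    (Equivalence.to (half-dominating⇔ S) dom)
    where
    image≤ : ∀ {b} (p : Fin (m * n) → Fin b) → count (image (lookup S) p) ≤ ∣ S ∣
    image≤ p = subst (count (image (lookup S) p) ≤_) (sym (∣∣≡count S)) (count-image≤ (lookup S) p)

  module _ {k} (k≤m : k ≤ m) (k≤n : k ≤ n) where

    diag : Fin k → Fin (m * n)
    diag u = combine (inject≤ u k≤m) (inject≤ u k≤n)

    diagonal : Subset (m * n)
    diagonal = tabulate (image (λ _ → true) diag)

    ∣diagonal∣≤k : ∣ diagonal ∣ ≤ k
    ∣diagonal∣≤k = begin
      ∣ diagonal ∣                     ≡⟨ ∣∣≡count diagonal ⟩
      count (lookup diagonal)          ≡⟨ count-cong (lookup∘tabulate (image (λ _ → true) diag)) ⟩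
      count (image (λ _ → true) diag) ≤⟨ count-image≤ (λ _ → true) diag ⟩
      count {k} (λ _ → true)           ≡⟨ count-true ⟩
      k                                ∎
      where open ≤-Reasoning

    diag∈diagonal : ∀ u → T (lookup diagonal (diag u))
    diag∈diagonal u = subst T (sym (lookup∘tabulate _ (diag u))) (image-∋ (λ _ → true) diag u tt)

    k≤rows : k ≤ count (rows diagonal)
    k≤rows = count-≥-initial k≤m (rows diagonal) λ u →
      subst (T ∘ rows diagonal) (row-combine _ _) (image-∋ (lookup diagonal) row (diag u) (diag∈diagonal u))

    k≤cols : k ≤ count (cols diagonal)
    k≤cols = count-≥-initial k≤n (cols diagonal) λ u →
      subst (T ∘ cols diagonal) (col-combine _ _) (image-∋ (lookup diagonal) col (diag u) (diag∈diagonal u))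

    diagonal-half-dominating : 2 * ((m ∸ k) * (n ∸ k)) ≤ m * n → IsPDominating 1 2 (K m □ K n) diagonal
    diagonal-half-dominating half = Equivalence.from (half-dominating⇔ diagonal)
      (≤-trans (*-monoʳ-≤ 2 (*-mono-≤ (∸-monoʳ-≤ m k≤rows) (∸-monoʳ-≤ n k≤cols))) half)

mainTheorem2 : (m n : ℕ) → 1 ≤ m → 1 ≤ n → (k : ℕ) → IsCeilFormula m n k →
    IsGammaP 1 2 (K m □ K n) k
mainTheorem2 m n _ _ k ceil = record
  { witness     = diagonal k≤m k≤n
  ; witnessSize = ≤-antisym (∣diagonal∣≤k k≤m k≤n) (minimal (diagonal k≤m k≤n) dominating)
  ; witnessDom  = dominating
  ; minimal     = minimal
  }
  where
  open IsCeilFormula ceil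
  open RookGraph m n
  k≤m : k ≤ m
  k≤m = least m (ceilBound-≥ˡ m n ≤-refl)
  k≤n : k ≤ n
  k≤n = least n (ceilBound-≥ʳ m n ≤-refl)
  minimal : ∀ S → IsPDominating 1 2 (K m □ K n) S → k ≤ ∣ S ∣
  minimal S dom = least ∣ S ∣ (ceilBound-of-half ∣ S ∣ (half-dominating⇒ S dom))
  dominating : IsPDominating 1 2 (K m □ K n) (diagonal k≤m k≤n)
  dominating = diagonal-half-dominating k≤m k≤n (Equivalence.to (ceilBound⇔ k≤m k≤n) satisfies)
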